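{- Assume Markov's principle. (1) Every countably based sober space is a space with limit passing. (2) If $(Y,\mathcal{T}_B)$ is a space with limit passing, with base $(B_n)_{n\in\mathbb{N}}$, and $X\subseteq Y$ is a stable subset, then $X$ with the subspace topology generated by the base $B'_n = X\cap B_n$ is again a space with limit passing.
   Context: We work constructively with Dependent Choice. $\Sigma = \{p \in \Omega \mid \exists f \in 2^{\mathbb{N}}\,(p \Leftrightarrow \exists n\, f(n)=1)\}$; semidecidable subsets are maps into $\Sigma$. Markov's principle: if a binary sequence is not everywhere zero then it contains a $1$. A set is countable if there is a surjection $\mathbb{N}\to\{\star\}+I$. A countably based space $(X,\mathcal{T}_B)$ is a set $X$ with a chosen family $B:\mathbb{N}\to\Sigma^X$ such that the collection $\mathcal{T}_B$ of all countable unions $\bigcup_{i\in I}B_i$ ($I\subseteq\mathbb{N}$ countable) is closed under finite intersections (including $X$); its basic neighborhood filter is $\nu : X\to\Sigma^{\mathbb{N}}$, $\nu(x)=\{i\in\mathbb{N}\mid x\in B_i\}$. It is $T_0$ if $\nu$ is injective. It is sober if the map $x\mapsto\hat{x}$, $\hat{x}(U)=(x\in U)$, from $X$ to the set of maps $\mathcal{T}_B\to\Sigma$ preserving finite intersections and countable unions, is a bijection. A subset $X\subseteq Y$ is stable if $\neg\neg(y\in X)\Rightarrow y\in X$. A space with limit passing is a countably based $T_0$-space whose basic neighborhood filter has stable image: for every $S\in\Sigma^{\mathbb{N}}$, if $\neg\neg\exists x\in X\,S=\nu(x)$ then there is $x\in X$ with $S=\nu(x)$. -}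

module Defs where

open import Level using (Level)
open import Data.Nat using (ℕ)
open import Data.Bool using (Bool; true; false)
open import Data.Maybe using (Maybe; just; nothing)
open import Data.Product using (Σ; ∃; ∃-syntax; _×_; _,_; proj₁; proj₂)
open import Relation.Binary.PropositionalEquality using (_≡_)
open import Relation.Nullary using (¬_)
open import Function.Bundles using (_⇔_)

-- Σ (Sierpinski truth values) presented by binary sequences:
-- a sequence s denotes the proposition ⟦ s ⟧ = ∃ n (s n = 1);
-- two elements of Σ are equal iff their propositions are equivalent.
Sier : Set
Sier = ℕ → Bool

⟦_⟧ : Sier → Set
⟦ s ⟧ = ∃[ n ] s n ≡ true

MarkovPrinciple : Set
MarkovPrinciple = (f : ℕ → Bool) → ¬ (∀ n → f n ≡ false) → ∃[ n ] f n ≡ true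

-- A countable subset I ⊆ ℕ, given by a surjection ℕ → {⋆} + I
-- (nothing = ⋆, just i = i ∈ I).  It codes the open ⋃_{i ∈ I} B_i.
OpenCode : Set
OpenCode = ℕ → Maybe ℕ

module _ {ℓ : Level} {X : Set ℓ} (B : ℕ → X → Sier) where

  _∈O_ : X → OpenCode → Set
  x ∈O U = ∃[ n ] ∃[ i ] (U n ≡ just i × ⟦ B i x ⟧)

record CBSpace {ℓ : Level} (X : Set ℓ) : Set ℓ where
  field
    B     : ℕ → X → Sier
    top   : ∃[ W ] (∀ x → _∈O_ B x W)
    inter : ∀ U V → ∃[ W ] (∀ x → _∈O_ B x W ⇔ (_∈O_ B x U × _∈O_ B x V))

module _ {ℓ : Level} {X : Set ℓ} (S : CBSpace X) where
  open CBSpace S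

  ν : X → ℕ → Sier
  ν x i = B i x

  _∈_ : X → OpenCode → Set
  x ∈ U = _∈O_ B x U

  T0 : Set ℓ
  T0 = ∀ x y → (∀ i → ⟦ ν x i ⟧ ⇔ ⟦ ν y i ⟧) → x ≡ y

  record IsPoint (h : OpenCode → Sier) : Set ℓ where
    field
      respects : ∀ U V → (∀ x → x ∈ U ⇔ x ∈ V) → ⟦ h U ⟧ ⇔ ⟦ h V ⟧
      pres-top : ∀ W → (∀ x → x ∈ W) → ⟦ h W ⟧
      pres-∩   : ∀ U V W → (∀ x → x ∈ W ⇔ (x ∈ U × x ∈ V))
                 → ⟦ h W ⟧ ⇔ (⟦ h U ⟧ × ⟦ h V ⟧)
      -- a countable family of opens is given by a surjection ℕ → {⋆} + J
      pres-⋃   : ∀ (F : ℕ → Maybe OpenCode) W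
                 → (∀ x → x ∈ W ⇔ (∃[ j ] ∃[ U ] (F j ≡ just U × x ∈ U)))
                 → ⟦ h W ⟧ ⇔ (∃[ j ] ∃[ U ] (F j ≡ just U × ⟦ h U ⟧))

  record Sober : Set ℓ where
    field
      injective  : ∀ x y → (∀ U → x ∈ U ⇔ y ∈ U) → x ≡ y
      surjective : ∀ h → IsPoint h → ∃[ x ] (∀ U → ⟦ h U ⟧ ⇔ x ∈ U)

  StableImage : Set ℓ
  StableImage = ∀ (T : ℕ → Sier)
    → ¬ ¬ (∃[ x ] (∀ i → ⟦ T i ⟧ ⇔ ⟦ ν x i ⟧))
    → ∃[ x ] (∀ i → ⟦ T i ⟧ ⇔ ⟦ ν x i ⟧)

  LimitPassing : Set ℓ
  LimitPassing = T0 × StableImage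

-- subsets are proposition-valued predicates
IsPropPred : ∀ {ℓ p} {Y : Set ℓ} → (Y → Set p) → Set _
IsPropPred P = ∀ y (a b : P y) → a ≡ b

Stable : ∀ {ℓ p} {Y : Set ℓ} → (Y → Set p) → Set _
Stable P = ∀ y → ¬ ¬ P y → P y

subspace : ∀ {ℓ p} {Y : Set ℓ} → CBSpace Y → (P : Y → Set p) → CBSpace (Σ Y P)
subspace {Y = Y} S P = record
  { B     = λ i x → CBSpace.B S i (proj₁ x)
  ; top   = proj₁ (CBSpace.top S) , λ x → proj₂ (CBSpace.top S) (proj₁ x)
  ; inter = λ U V → proj₁ (CBSpace.inter S U V)
                  , λ x → proj₂ (CBSpace.inter S U V) (proj₁ x)
  }

-- Under Markov's principle every element ⟦ s ⟧ of Σ is ¬¬-stable, and so is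
-- the statement that a map 𝒯_B → Σ is a point, all of whose clauses are
-- built from elements of Σ.  Given T ∈ Σ^ℕ that is ¬¬ the filter of some x,
-- the map U ↦ ∃ i ∈ U. T i is therefore ¬¬ equal to x̂, hence a point, and
-- sobriety produces an actual x with filter T.  For a stable subspace the
-- limit found in Y is ¬¬ in X, hence in X, and T0 is inherited because
-- membership in X is proof-irrelevant.
{-# OPTIONS --safe #-}
module Submission where

open import Defs
open import Level using (Level)
open import Data.Product using (_×_; _,_; proj₁; proj₂; ∃-syntax)
open import Data.Product.Function.NonDependent.Propositional using (_×-⇔_)
open import Data.Nat using (ℕ; zero; suc; _+_)
open import Data.Nat.Properties using (+-suc; +-identityʳ)
open import Data.Bool using (false)
open import Data.Maybe using (Maybe; just; maybe′)
open import Function using (_∘_)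
open import Function.Bundles using (_⇔_; mk⇔; Equivalence)
open import Function.Properties.Equivalence using () renaming (sym to ⇔-sym; trans to ⇔-trans)
open import Relation.Binary.PropositionalEquality
  using (_≡_; refl; sym; trans; cong; subst)
open import Relation.Nullary.Negation.Core using (¬_; ¬¬-map)
import Relation.Nullary.Negation.Core as Nullary

open Equivalence using (to; from)

private
  variable
    a b p q : Level
    A : Set a
    B : Set b

zigzag : ℕ × ℕ → ℕ × ℕ
zigzag (zero  , b) = suc b , zero
zigzag (suc a , b) = a , suc b

unpair : ℕ → ℕ × ℕ
unpair zero    = zero , zero
unpair (suc k) = zigzag (unpair k)

unpair-descends : ∀ a b {k} → unpair k ≡ (b + a , 0) → unpair (b + k) ≡ (a , b)
unpair-descends a zero    e = e
unpair-descends a (suc b) e =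
  cong zigzag (unpair-descends (suc a) b (trans e (cong (_, 0) (sym (+-suc b a)))))

unpair-axis : ∀ s → ∃[ k ] unpair k ≡ (s , 0)
unpair-axis zero    = 0 , refl
unpair-axis (suc s) with unpair-axis s
... | k , e = suc (s + k)
            , cong zigzag (unpair-descends 0 s (trans e (cong (_, 0) (sym (+-identityʳ s)))))

unpair-surjective : ∀ a b → ∃[ k ] unpair k ≡ (a , b)
unpair-surjective a b with unpair-axis (b + a)
... | k , e = b + k , unpair-descends a b e

-- `_∈O_` and the union clause of `IsPoint` are instances of Some, definitionally.
Some : (ℕ → Maybe A) → (A → Set p) → Set _
Some F P = ∃[ n ] ∃[ x ] (F n ≡ just x × P x)

Some-map : ∀ {F : ℕ → Maybe A} {P : A → Set p} {Q : A → Set q}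
  → (∀ {x} → P x → Q x) → Some F P → Some F Q
Some-map f (n , x , e , px) = n , x , e , f px

Some-cong : ∀ {F : ℕ → Maybe A} {P : A → Set p} {Q : A → Set q}
  → (∀ x → P x ⇔ Q x) → Some F P ⇔ Some F Q
Some-cong P⇔Q = mk⇔ (Some-map (to (P⇔Q _))) (Some-map (from (P⇔Q _)))

Some-singleton : ∀ {x : A} {P : A → Set p} → Some (λ _ → just x) P ⇔ P x
Some-singleton = mk⇔ (λ { (_ , _ , refl , px) → px }) (λ px → 0 , _ , refl , px)

⋁ : (ℕ → Maybe A) → (A → Sier) → Sier
⋁ F G k = maybe′ (λ x → G x (proj₂ (unpair k))) false (F (proj₁ (unpair k)))

⋁-⇔ : (F : ℕ → Maybe A) (G : A → Sier) → ⟦ ⋁ F G ⟧ ⇔ Some F (⟦_⟧ ∘ G)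
⋁-⇔ F G = mk⇔ sound complete
  where
  sound : ⟦ ⋁ F G ⟧ → Some F (⟦_⟧ ∘ G)
  sound (k , e) with unpair k
  ... | n , m with F n in eq
  ...   | just x = n , x , eq , m , e

  complete : Some F (⟦_⟧ ∘ G) → ⟦ ⋁ F G ⟧
  complete (n , x , eq , m , e) with unpair-surjective n m
  ... | k , u = k , subst (λ nm → maybe′ (λ x → G x (proj₂ nm)) false (F (proj₁ nm)) ≡ _)
                          (sym u) (trans (cong (maybe′ _ false) eq) e)

⟦⟧-stable : MarkovPrinciple → Stable ⟦_⟧
⟦⟧-stable mp s ¬¬s = mp s (λ all-false → ¬¬s (λ { (n , e) → false≢true (trans (sym (all-false n)) e) }))
  where
  false≢true : ¬ false ≡ _
  false≢true ()

Some-⟦⟧-stable : MarkovPrinciple → (F : ℕ → Maybe A) (G : A → Sier)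
  → Nullary.Stable (Some F (⟦_⟧ ∘ G))
Some-⟦⟧-stable mp F G ¬¬some =
  to (⋁-⇔ F G) (⟦⟧-stable mp (⋁ F G) (¬¬-map (from (⋁-⇔ F G)) ¬¬some))

×-stable : Nullary.Stable A → Nullary.Stable B → Nullary.Stable (A × B)
×-stable stA stB ¬¬ab = stA (¬¬-map proj₁ ¬¬ab) , stB (¬¬-map proj₂ ¬¬ab)

→-stable : Nullary.Stable B → Nullary.Stable (A → B)
→-stable stB ¬¬f x = stB (¬¬-map (λ f → f x) ¬¬f)

⇔-stable : Nullary.Stable A → Nullary.Stable B → Nullary.Stable (A ⇔ B)
⇔-stable stA stB ¬¬e =
  mk⇔ (→-stable stB (¬¬-map to ¬¬e)) (→-stable stA (¬¬-map from ¬¬e))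

module _ {ℓ : Level} {X : Set ℓ} (S : CBSpace X) where
  open CBSpace S
  open IsPoint

  Represents : (OpenCode → Sier) → X → Set
  Represents h x = ∀ U → ⟦ h U ⟧ ⇔ _∈_ S x U

  HasFilter : (ℕ → Sier) → X → Set
  HasFilter T x = ∀ i → ⟦ T i ⟧ ⇔ ⟦ ν S x i ⟧

  represented⇒isPoint : ∀ {h x} → Represents h x → IsPoint S h
  represented⇒isPoint {x = x} r = record
    { respects = λ U V U≈V → ⇔-trans (r U) (⇔-trans (U≈V x) (⇔-sym (r V)))
    ; pres-top = λ W W-full → from (r W) (W-full x)
    ; pres-∩   = λ U V W W≈ → ⇔-trans (r W) (⇔-trans (W≈ x) (⇔-sym (r U ×-⇔ r V)))
    ; pres-⋃   = λ F W W≈ → ⇔-trans (r W) (⇔-trans (W≈ x) (Some-cong (⇔-sym ∘ r)))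
    }

  isPoint-stable : MarkovPrinciple → ∀ {h} → Nullary.Stable (IsPoint S h)
  isPoint-stable mp {h} ¬¬pt = record
    { respects = λ U V U≈V → ⇔-stable (st _) (st _) (¬¬-map (λ pt → respects pt U V U≈V) ¬¬pt)
    ; pres-top = λ W W-full → st _ (¬¬-map (λ pt → pres-top pt W W-full) ¬¬pt)
    ; pres-∩   = λ U V W W≈ → ⇔-stable (st _) (×-stable (st _) (st _))
                                 (¬¬-map (λ pt → pres-∩ pt U V W W≈) ¬¬pt)
    ; pres-⋃   = λ F W W≈ → ⇔-stable (st _) (Some-⟦⟧-stable mp F h)
                                 (¬¬-map (λ pt → pres-⋃ pt F W W≈) ¬¬pt)
    }
    where
    st = ⟦⟧-stable mp

  filter⇒represents : ∀ {T x} → HasFilter T x → Represents (λ U → ⋁ U T) x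
  filter⇒represents {T} f U = ⇔-trans (⋁-⇔ U T) (Some-cong f)

  represents⇒filter : ∀ {T x} → Represents (λ U → ⋁ U T) x → HasFilter T x
  represents⇒filter {T} r i =
    ⇔-trans (⇔-sym Some-singleton)
      (⇔-trans (⇔-sym (⋁-⇔ _ T)) (⇔-trans (r (λ _ → just i)) Some-singleton))

  sober⇒T0 : Sober S → T0 S
  sober⇒T0 sob x y ν≈ = Sober.injective sob x y (λ U → Some-cong ν≈)

  sober⇒stableImage : MarkovPrinciple → Sober S → StableImage S
  sober⇒stableImage mp sob T ¬¬filter =
    let x , r = Sober.surjective sob (λ U → ⋁ U T) point in x , represents⇒filter r
    where
    point : IsPoint S (λ U → ⋁ U T)
    point = isPoint-stable mp (¬¬-map (represented⇒isPoint ∘ filter⇒represents ∘ proj₂) ¬¬filter)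

  sober⇒limitPassing : MarkovPrinciple → Sober S → LimitPassing S
  sober⇒limitPassing mp sob = sober⇒T0 sob , sober⇒stableImage mp sob

  T0⇒filter-unique : T0 S → ∀ {T x y} → HasFilter T x → HasFilter T y → x ≡ y
  T0⇒filter-unique t0 {x = x} {y} fx fy = t0 x y (λ i → ⇔-trans (⇔-sym (fx i)) (fy i))

  module _ {p : Level} {P : X → Set p} where

    subspace-T0 : IsPropPred P → T0 S → T0 (subspace S P)
    subspace-T0 prop t0 (x , px) (y , py) ν≈ with t0 x y ν≈
    ... | refl = cong (x ,_) (prop x px py)

    subspace-stableImage : Stable P → LimitPassing S → StableImage (subspace S P)
    subspace-stableImage stable (t0 , image-stable) T ¬¬filter
      with image-stable T (¬¬-map (λ ((y , _) , f) → y , f) ¬¬filter)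
    ... | y , f = (y , stable y (¬¬-map in-subspace ¬¬filter)) , f
      where
      in-subspace : ∃[ z ] HasFilter T (proj₁ z) → P y
      in-subspace ((y' , py') , f') = subst P (T0⇒filter-unique t0 f' f) py'

    subspace-limitPassing : IsPropPred P → Stable P → LimitPassing S
      → LimitPassing (subspace S P)
    subspace-limitPassing prop stable lp =
      subspace-T0 prop (proj₁ lp) , subspace-stableImage stable lp

proposition4p13 : ∀ {ℓ : Level} → MarkovPrinciple
    → ((X : Set ℓ) (S : CBSpace X) → Sober S → LimitPassing S)
    × ((Y : Set ℓ) (S : CBSpace Y) (P : Y → Set ℓ)
    → IsPropPred P → Stable P → LimitPassing S
    → LimitPassing (subspace S P))
proposition4p13 mp = (λ X S → sober⇒limitPassing S mp)
                   , (λ Y S P → subspace-limitPassing S)
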